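{- Let $S$ be a Kleene relation algebra satisfying the Tarski rule, let $x \in S$ be a forest and let $y \in S$ be a vector. Then $(y \sqcap (x\cdot x)) \sqcup (\overline{y} \sqcap x)$ is a forest.
   Context: A Kleene relation algebra is a structure $(S,\sqcup,\sqcap,\cdot,\overline{\phantom{x}},{}^T,{}^*,\bot,\top,1)$ such that $(S,\sqcup,\sqcap,\overline{\phantom{x}},\bot,\top)$ is a Boolean algebra with order $x \sqsubseteq y \iff x \sqcup y = y$; $(S,\sqcup,\cdot,\bot,1)$ is an idempotent semiring ($\cdot$ associative with two-sided unit $1$, distributing over $\sqcup$, $\bot$ a two-sided zero of $\cdot$); transposition satisfies $(x\sqcup y)^T = x^T \sqcup y^T$, $(x^T)^T = x$, $(x\cdot y)^T = y^T\cdot x^T$ and $(x\cdot y)\sqcap z \sqsubseteq x\cdot(y\sqcap(x^T\cdot z))$; and the star satisfies $1\sqcup y\cdot y^* = y^* = 1 \sqcup y^*\cdot y$, $z\sqcup y\cdot x\sqsubseteq x \Rightarrow y^*\cdot z\sqsubseteq x$, $z \sqcup x\cdot y \sqsubseteq x \Rightarrow z\cdot y^*\sqsubseteq x$. The Tarski rule states $\top\cdot x\cdot\top = \top$ for every $x \neq \bot$. Write $x^+ = x\cdot x^*$. An element $x$ is univalent if $x^T x\sqsubseteq 1$, total if $1\sqsubseteq x x^T$, a mapping if univalent and total, a vector if $x\cdot\top = x$, acyclic if $x^+\sqsubseteq\overline 1$, and a forest if $x$ is a mapping and $x\sqcap\overline{1}$ is acyclic. (The element in the claim is the array update of $x$ at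 indices $y$ to value $(x\cdot x)^T$, i.e. $(y\sqcap ((x\cdot x)^T)^T)\sqcup(\overline y\sqcap x)$.) -}

module Defs where

open import Level using (Level) renaming (suc to lsuc)
open import Relation.Binary.PropositionalEquality using (_≡_)
open import Relation.Nullary using (¬_)
open import Data.Product using (_×_)

record KleeneRelationAlgebra (ℓ : Level) : Set (lsuc ℓ) where
  infixl 6 _⊔_
  infixl 7 _⊓_
  infixl 8 _·_
  field
    S    : Set ℓ
    _⊔_  : S → S → S
    _⊓_  : S → S → S
    _·_  : S → S → S
    -_   : S → S
    _ᵀ   : S → S
    _*   : S → S
    ⊥    : S
    ⊤    : S
    𝟏    : S

  _⊑_ : S → S → Set ℓ
  x ⊑ y = x ⊔ y ≡ y

  field
    ⊔-assoc   : ∀ x y z → (x ⊔ y) ⊔ z ≡ x ⊔ (y ⊔ z)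
    ⊔-comm    : ∀ x y → x ⊔ y ≡ y ⊔ x
    ⊓-assoc   : ∀ x y z → (x ⊓ y) ⊓ z ≡ x ⊓ (y ⊓ z)
    ⊓-comm    : ∀ x y → x ⊓ y ≡ y ⊓ x
    ⊔-absorb  : ∀ x y → x ⊔ (x ⊓ y) ≡ x
    ⊓-absorb  : ∀ x y → x ⊓ (x ⊔ y) ≡ x
    ⊓-distrib : ∀ x y z → x ⊓ (y ⊔ z) ≡ (x ⊓ y) ⊔ (x ⊓ z)
    ⊔-⊥       : ∀ x → x ⊔ ⊥ ≡ x
    ⊓-⊤       : ∀ x → x ⊓ ⊤ ≡ x
    compl-⊔   : ∀ x → x ⊔ (- x) ≡ ⊤
    compl-⊓   : ∀ x → x ⊓ (- x) ≡ ⊥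
    ·-assoc     : ∀ x y z → (x · y) · z ≡ x · (y · z)
    ·-identityˡ : ∀ x → 𝟏 · x ≡ x
    ·-identityʳ : ∀ x → x · 𝟏 ≡ x
    ·-distribˡ  : ∀ x y z → x · (y ⊔ z) ≡ (x · y) ⊔ (x · z)
    ·-distribʳ  : ∀ x y z → (y ⊔ z) · x ≡ (y · x) ⊔ (z · x)
    ·-zeroˡ     : ∀ x → ⊥ · x ≡ ⊥
    ·-zeroʳ     : ∀ x → x · ⊥ ≡ ⊥
    ᵀ-⊔      : ∀ x y → (x ⊔ y) ᵀ ≡ (x ᵀ) ⊔ (y ᵀ)
    ᵀ-invol  : ∀ x → (x ᵀ) ᵀ ≡ x
    ᵀ-·      : ∀ x y → (x · y) ᵀ ≡ (y ᵀ) · (x ᵀ)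
    dedekind : ∀ x y z → ((x · y) ⊓ z) ⊑ (x · (y ⊓ ((x ᵀ) · z)))
    star-unfoldˡ : ∀ y → 𝟏 ⊔ (y · (y *)) ≡ y *
    star-unfoldʳ : ∀ y → 𝟏 ⊔ ((y *) · y) ≡ y *
    star-inductˡ : ∀ x y z → (z ⊔ (y · x)) ⊑ x → ((y *) · z) ⊑ x
    star-inductʳ : ∀ x y z → (z ⊔ (x · y)) ⊑ x → (z · (y *)) ⊑ x

  TarskiRule : Set ℓ
  TarskiRule = ∀ x → ¬ (x ≡ ⊥) → (⊤ · x) · ⊤ ≡ ⊤

  _⁺ : S → S
  x ⁺ = x · (x *)

  univalent : S → Set ℓ
  univalent x = ((x ᵀ) · x) ⊑ 𝟏

  total : S → Set ℓ
  total x = 𝟏 ⊑ (x · (x ᵀ))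

  mapping : S → Set ℓ
  mapping x = univalent x × total x

  vector : S → Set ℓ
  vector x = x · ⊤ ≡ x

  acyclic : S → Set ℓ
  acyclic x = (x ⁺) ⊑ (- 𝟏)

  forest : S → Set ℓ
  forest x = mapping x × acyclic (x ⊓ (- 𝟏))

{-# OPTIONS --safe #-}
module Submission where

-- The update agrees with x · x on the vector y and with x on its complement.
-- Because y is a vector the two pieces have disjoint domains, so univalence
-- and totality pass from x and x · x to the update.  Every edge of the update
-- lies in q * for q = x ⊓ ‾1, so its loop-free part has its transitive closure
-- inside q ⁺, which is irreflexive because x is a forest.

open import Data.Product using (_,_)
open import Relation.Binary.Bundles using (Poset)
open import Relation.Binary.Structures using (IsPartialOrder)
open import Relation.Binary.PropositionalEquality
  using (_≡_; refl; sym; trans; cong; cong₂; subst₂; isEquivalence)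
import Relation.Binary.Reasoning.PartialOrder as PosetReasoning

open import Defs

module KleeneRelationAlgebraProperties {ℓ} (K : KleeneRelationAlgebra ℓ) where
  open KleeneRelationAlgebra K

  ⊔-idem : ∀ x → x ⊔ x ≡ x
  ⊔-idem x = trans (cong (x ⊔_) (sym (⊓-absorb x x))) (⊔-absorb x (x ⊔ x))

  ⊓-idem : ∀ x → x ⊓ x ≡ x
  ⊓-idem x = trans (cong (x ⊓_) (sym (⊔-absorb x x))) (⊓-absorb x (x ⊓ x))

  ⊑-refl : ∀ {x} → x ⊑ x
  ⊑-refl {x} = ⊔-idem x

  ⊑-reflexive : ∀ {x y} → x ≡ y → x ⊑ y
  ⊑-reflexive refl = ⊑-refl

  ⊑-trans : ∀ {x y z} → x ⊑ y → y ⊑ z → x ⊑ z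
  ⊑-trans {x} {y} {z} x⊑y y⊑z =
    trans (cong (x ⊔_) (sym y⊑z))
      (trans (sym (⊔-assoc x y z)) (trans (cong (_⊔ z) x⊑y) y⊑z))

  ⊑-antisym : ∀ {x y} → x ⊑ y → y ⊑ x → x ≡ y
  ⊑-antisym {x} {y} x⊑y y⊑x = trans (sym y⊑x) (trans (⊔-comm y x) x⊑y)

  ⊑-isPartialOrder : IsPartialOrder _≡_ _⊑_
  ⊑-isPartialOrder = record
    { isPreorder = record
      { isEquivalence = isEquivalence
      ; reflexive     = ⊑-reflexive
      ; trans         = ⊑-trans
      }
    ; antisym = ⊑-antisym
    }

  ⊑-poset : Poset ℓ ℓ ℓ
  ⊑-poset = record { isPartialOrder = ⊑-isPartialOrder }

  open PosetReasoning ⊑-poset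

  ⊑⇒⊓≡ : ∀ {x y} → x ⊑ y → x ⊓ y ≡ x
  ⊑⇒⊓≡ {x} {y} x⊑y = trans (cong (x ⊓_) (sym x⊑y)) (⊓-absorb x y)

  ⊓≡⇒⊑ : ∀ {x y} → x ⊓ y ≡ x → x ⊑ y
  ⊓≡⇒⊑ {x} {y} x⊓y≡x = begin-equality
    x ⊔ y        ≡⟨ cong (_⊔ y) x⊓y≡x ⟨
    x ⊓ y ⊔ y    ≡⟨ ⊔-comm (x ⊓ y) y ⟩
    y ⊔ x ⊓ y    ≡⟨ cong (y ⊔_) (⊓-comm x y) ⟩
    y ⊔ y ⊓ x    ≡⟨ ⊔-absorb y x ⟩
    y            ∎

  x⊑x⊔y : ∀ x y → x ⊑ (x ⊔ y)
  x⊑x⊔y x y = trans (sym (⊔-assoc x x y)) (cong (_⊔ y) (⊔-idem x))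

  y⊑x⊔y : ∀ x y → y ⊑ (x ⊔ y)
  y⊑x⊔y x y = subst₂ _⊑_ refl (⊔-comm y x) (x⊑x⊔y y x)

  ⊔-least : ∀ {x y z} → x ⊑ z → y ⊑ z → (x ⊔ y) ⊑ z
  ⊔-least {x} {y} {z} x⊑z y⊑z = trans (⊔-assoc x y z) (trans (cong (x ⊔_) y⊑z) x⊑z)

  x⊓y⊑x : ∀ x y → (x ⊓ y) ⊑ x
  x⊓y⊑x x y = ⊓≡⇒⊑ (trans (⊓-comm (x ⊓ y) x) (trans (sym (⊓-assoc x x y)) (cong (_⊓ y) (⊓-idem x))))

  x⊓y⊑y : ∀ x y → (x ⊓ y) ⊑ y
  x⊓y⊑y x y = ⊓≡⇒⊑ (trans (⊓-assoc x y y) (cong (x ⊓_) (⊓-idem y)))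

  ⊓-greatest : ∀ {x y z} → z ⊑ x → z ⊑ y → z ⊑ (x ⊓ y)
  ⊓-greatest {x} {y} {z} z⊑x z⊑y =
    ⊓≡⇒⊑ (trans (sym (⊓-assoc z x y)) (trans (cong (_⊓ y) (⊑⇒⊓≡ z⊑x)) (⊑⇒⊓≡ z⊑y)))

  ⊥⊑x : ∀ x → ⊥ ⊑ x
  ⊥⊑x x = trans (⊔-comm ⊥ x) (⊔-⊥ x)

  x⊑⊤ : ∀ x → x ⊑ ⊤
  x⊑⊤ x = ⊓≡⇒⊑ (⊓-⊤ x)

  ⊓-mono : ∀ {a b c d} → a ⊑ b → c ⊑ d → (a ⊓ c) ⊑ (b ⊓ d)
  ⊓-mono {a} {c = c} a⊑b c⊑d =
    ⊓-greatest (⊑-trans (x⊓y⊑x a c) a⊑b) (⊑-trans (x⊓y⊑y a c) c⊑d)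

  ·-monoʳ : ∀ {a b} c → a ⊑ b → (c · a) ⊑ (c · b)
  ·-monoʳ {a} {b} c a⊑b = trans (sym (·-distribˡ c a b)) (cong (c ·_) a⊑b)

  ·-monoˡ : ∀ {a b} c → a ⊑ b → (a · c) ⊑ (b · c)
  ·-monoˡ {a} {b} c a⊑b = trans (sym (·-distribʳ c a b)) (cong (_· c) a⊑b)

  ·-mono : ∀ {a b c d} → a ⊑ b → c ⊑ d → (a · c) ⊑ (b · d)
  ·-mono {b = b} {c} a⊑b c⊑d = ⊑-trans (·-monoˡ c a⊑b) (·-monoʳ b c⊑d)

  ⊔·⊔-least : ∀ {p q r s t} → (p · r) ⊑ t → (p · s) ⊑ t → (q · r) ⊑ t → (q · s) ⊑ t →
              ((p ⊔ q) · (r ⊔ s)) ⊑ t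
  ⊔·⊔-least {p} {q} {r} {s} pr qr ps qs = begin
    (p ⊔ q) · (r ⊔ s)                    ≡⟨ ·-distribʳ (r ⊔ s) p q ⟩
    p · (r ⊔ s) ⊔ q · (r ⊔ s)            ≡⟨ cong₂ _⊔_ (·-distribˡ p r s) (·-distribˡ q r s) ⟩
    (p · r ⊔ p · s) ⊔ (q · r ⊔ q · s)    ≤⟨ ⊔-least (⊔-least pr qr) (⊔-least ps qs) ⟩
    _                                    ∎

  ⊓-compl-split : ∀ z y → z ≡ z ⊓ y ⊔ z ⊓ (- y)
  ⊓-compl-split z y = begin-equality
    z                      ≡⟨ ⊓-⊤ z ⟨
    z ⊓ ⊤                  ≡⟨ cong (z ⊓_) (compl-⊔ y) ⟨
    z ⊓ (y ⊔ (- y))        ≡⟨ ⊓-distrib z y (- y) ⟩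
    z ⊓ y ⊔ z ⊓ (- y)      ∎

  compl-⊓ˡ : ∀ y → (- y) ⊓ y ≡ ⊥
  compl-⊓ˡ y = trans (⊓-comm (- y) y) (compl-⊓ y)

  disjoint⇒⊑compl : ∀ {z y} → (z ⊓ y) ⊑ ⊥ → z ⊑ (- y)
  disjoint⇒⊑compl {z} {y} z⊓y⊑⊥ = begin
    z                      ≡⟨ ⊓-compl-split z y ⟩
    z ⊓ y ⊔ z ⊓ (- y)      ≤⟨ ⊔-least (⊑-trans z⊓y⊑⊥ (⊥⊑x _)) (x⊓y⊑y z (- y)) ⟩
    - y                    ∎

  ᵀ-mono : ∀ {a b} → a ⊑ b → (a ᵀ) ⊑ (b ᵀ)
  ᵀ-mono {a} {b} a⊑b = trans (sym (ᵀ-⊔ a b)) (cong _ᵀ a⊑b)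

  ᵀ-reflects-⊑ : ∀ {a b} → (a ᵀ) ⊑ (b ᵀ) → a ⊑ b
  ᵀ-reflects-⊑ {a} {b} aᵀ⊑bᵀ = subst₂ _⊑_ (ᵀ-invol a) (ᵀ-invol b) (ᵀ-mono aᵀ⊑bᵀ)

  ᵀ-⊓ : ∀ a b → (a ⊓ b) ᵀ ≡ a ᵀ ⊓ b ᵀ
  ᵀ-⊓ a b = ⊑-antisym
    (⊓-greatest (ᵀ-mono (x⊓y⊑x a b)) (ᵀ-mono (x⊓y⊑y a b)))
    (ᵀ-reflects-⊑ (begin
      (a ᵀ ⊓ b ᵀ) ᵀ              ≤⟨ ⊓-greatest (ᵀ-mono (x⊓y⊑x (a ᵀ) (b ᵀ))) (ᵀ-mono (x⊓y⊑y (a ᵀ) (b ᵀ))) ⟩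
      (a ᵀ) ᵀ ⊓ (b ᵀ) ᵀ          ≡⟨ cong₂ _⊓_ (ᵀ-invol a) (ᵀ-invol b) ⟩
      a ⊓ b                      ≡⟨ ᵀ-invol (a ⊓ b) ⟨
      ((a ⊓ b) ᵀ) ᵀ              ∎))

  ᵀ-⊤ : ⊤ ᵀ ≡ ⊤
  ᵀ-⊤ = ⊑-antisym (x⊑⊤ (⊤ ᵀ)) (ᵀ-reflects-⊑ (⊑-trans (x⊑⊤ _) (⊑-reflexive (sym (ᵀ-invol ⊤)))))

  dedekindʳ : ∀ a b c → ((a · b) ⊓ c) ⊑ ((a ⊓ (c · b ᵀ)) · b)
  dedekindʳ a b c = ᵀ-reflects-⊑ (begin
    ((a · b) ⊓ c) ᵀ                      ≡⟨ trans (ᵀ-⊓ (a · b) c) (cong (_⊓ c ᵀ) (ᵀ-· a b)) ⟩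
    (b ᵀ · a ᵀ) ⊓ c ᵀ                    ≤⟨ dedekind (b ᵀ) (a ᵀ) (c ᵀ) ⟩
    b ᵀ · (a ᵀ ⊓ ((b ᵀ) ᵀ · c ᵀ))        ≡⟨ cong (λ t → b ᵀ · (a ᵀ ⊓ t)) (ᵀ-· c (b ᵀ)) ⟨
    b ᵀ · (a ᵀ ⊓ (c · b ᵀ) ᵀ)            ≡⟨ cong (b ᵀ ·_) (ᵀ-⊓ a (c · b ᵀ)) ⟨
    b ᵀ · (a ⊓ (c · b ᵀ)) ᵀ              ≡⟨ ᵀ-· (a ⊓ (c · b ᵀ)) b ⟨
    ((a ⊓ (c · b ᵀ)) · b) ᵀ              ∎)

  vector-·-⊑ : ∀ {v} → vector v → ∀ a → (v · a) ⊑ v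
  vector-·-⊑ {v} v-vec a = ⊑-trans (·-monoʳ v (x⊑⊤ a)) (⊑-reflexive v-vec)

  vector-compl : ∀ {v} → vector v → vector (- v)
  vector-compl {v} v-vec = ⊑-antisym (disjoint⇒⊑compl disjoint) (begin
    - v          ≡⟨ ·-identityʳ (- v) ⟨
    - v · 𝟏      ≤⟨ ·-monoʳ (- v) (x⊑⊤ 𝟏) ⟩
    - v · ⊤      ∎)
    where
    disjoint : ((- v · ⊤) ⊓ v) ⊑ ⊥
    disjoint = begin
      (- v · ⊤) ⊓ v              ≤⟨ dedekindʳ (- v) ⊤ v ⟩
      (- v ⊓ (v · ⊤ ᵀ)) · ⊤      ≡⟨ cong (λ t → (- v ⊓ t) · ⊤) (trans (cong (v ·_) ᵀ-⊤) v-vec) ⟩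
      (- v ⊓ v) · ⊤              ≡⟨ cong (_· ⊤) (compl-⊓ˡ v) ⟩
      ⊥ · ⊤                      ≡⟨ ·-zeroˡ ⊤ ⟩
      ⊥                          ∎

  vector-restriction-ᵀ·-disjoint : ∀ {v v'} u u' → vector v → (v' ⊓ v) ⊑ ⊥ →
                                   ((v ⊓ u) ᵀ · (v' ⊓ u')) ⊑ ⊥
  vector-restriction-ᵀ·-disjoint {v} {v'} u u' v-vec v'⊓v⊑⊥ = begin
    s · (v' ⊓ u')                        ≡⟨ ⊓-⊤ _ ⟨
    (s · (v' ⊓ u')) ⊓ ⊤                  ≤⟨ dedekind s (v' ⊓ u') ⊤ ⟩
    s · ((v' ⊓ u') ⊓ (s ᵀ · ⊤))          ≤⟨ ·-monoʳ s (⊓-mono (x⊓y⊑x v' u') domain) ⟩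
    s · (v' ⊓ v)                         ≤⟨ ·-monoʳ s v'⊓v⊑⊥ ⟩
    s · ⊥                                ≡⟨ ·-zeroʳ s ⟩
    ⊥                                    ∎
    where
    s : S
    s = (v ⊓ u) ᵀ
    domain : (s ᵀ · ⊤) ⊑ v
    domain = begin
      s ᵀ · ⊤        ≡⟨ cong (_· ⊤) (ᵀ-invol (v ⊓ u)) ⟩
      (v ⊓ u) · ⊤    ≤⟨ ·-monoˡ ⊤ (x⊓y⊑x v u) ⟩
      v · ⊤          ≡⟨ v-vec ⟩
      v              ∎

  vector-total-restriction : ∀ {v z} → vector v → total z → (𝟏 ⊓ v) ⊑ ((v ⊓ z) · (v ⊓ z) ᵀ)
  vector-total-restriction {v} {z} v-vec z-total = begin
    𝟏 ⊓ v                                ≤⟨ ⊓-greatest restricted (x⊓y⊑x 𝟏 v) ⟩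
    ((v ⊓ z) · z ᵀ) ⊓ 𝟏                  ≤⟨ dedekind (v ⊓ z) (z ᵀ) 𝟏 ⟩
    (v ⊓ z) · (z ᵀ ⊓ ((v ⊓ z) ᵀ · 𝟏))    ≤⟨ ·-monoʳ (v ⊓ z) (x⊓y⊑y _ _) ⟩
    (v ⊓ z) · ((v ⊓ z) ᵀ · 𝟏)            ≡⟨ cong ((v ⊓ z) ·_) (·-identityʳ _) ⟩
    (v ⊓ z) · (v ⊓ z) ᵀ                  ∎
    where
    restricted : (𝟏 ⊓ v) ⊑ ((v ⊓ z) · z ᵀ)
    restricted = begin
      𝟏 ⊓ v                          ≤⟨ ⊓-mono z-total ⊑-refl ⟩
      (z · z ᵀ) ⊓ v                  ≤⟨ dedekindʳ z (z ᵀ) v ⟩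
      (z ⊓ (v · (z ᵀ) ᵀ)) · z ᵀ      ≤⟨ ·-monoˡ (z ᵀ) (⊓-greatest (⊑-trans (x⊓y⊑y _ _) (vector-·-⊑ v-vec _)) (x⊓y⊑x _ _)) ⟩
      (v ⊓ z) · z ᵀ                  ∎

  univalent-antimono : ∀ {a u} → a ⊑ u → univalent u → univalent a
  univalent-antimono {a} {u} a⊑u u-univalent = begin
    a ᵀ · a      ≤⟨ ·-mono (ᵀ-mono a⊑u) a⊑u ⟩
    u ᵀ · u      ≤⟨ u-univalent ⟩
    𝟏            ∎

  univalent-· : ∀ {x y} → univalent x → univalent y → univalent (x · y)
  univalent-· {x} {y} x-univalent y-univalent = begin
    (x · y) ᵀ · (x · y)          ≡⟨ cong (_· (x · y)) (ᵀ-· x y) ⟩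
    (y ᵀ · x ᵀ) · (x · y)        ≡⟨ ·-assoc (y ᵀ) (x ᵀ) (x · y) ⟩
    y ᵀ · (x ᵀ · (x · y))        ≡⟨ cong (y ᵀ ·_) (·-assoc (x ᵀ) x y) ⟨
    y ᵀ · ((x ᵀ · x) · y)        ≤⟨ ·-monoʳ (y ᵀ) (·-monoˡ y x-univalent) ⟩
    y ᵀ · (𝟏 · y)                ≡⟨ cong (y ᵀ ·_) (·-identityˡ y) ⟩
    y ᵀ · y                      ≤⟨ y-univalent ⟩
    𝟏                            ∎

  total-· : ∀ {x y} → total x → total y → total (x · y)
  total-· {x} {y} x-total y-total = begin
    𝟏                            ≤⟨ x-total ⟩
    x · x ᵀ                      ≡⟨ cong (x ·_) (·-identityˡ (x ᵀ)) ⟨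
    x · (𝟏 · x ᵀ)                ≤⟨ ·-monoʳ x (·-monoˡ (x ᵀ) y-total) ⟩
    x · ((y · y ᵀ) · x ᵀ)        ≡⟨ cong (x ·_) (·-assoc y (y ᵀ) (x ᵀ)) ⟩
    x · (y · (y ᵀ · x ᵀ))        ≡⟨ ·-assoc x y (y ᵀ · x ᵀ) ⟨
    (x · y) · (y ᵀ · x ᵀ)        ≡⟨ cong ((x · y) ·_) (ᵀ-· x y) ⟨
    (x · y) · (x · y) ᵀ          ∎

  mapping-· : ∀ {x y} → mapping x → mapping y → mapping (x · y)
  mapping-· (x-univalent , x-total) (y-univalent , y-total) =
    univalent-· x-univalent y-univalent , total-· x-total y-total

  ·ᵀ-mono : ∀ {a b} → a ⊑ b → (a · a ᵀ) ⊑ (b · b ᵀ)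
  ·ᵀ-mono a⊑b = ·-mono a⊑b (ᵀ-mono a⊑b)

  -- cond y z x is the paper's array update x[y ← z ᵀ].
  cond : S → S → S → S
  cond v u u' = (v ⊓ u) ⊔ ((- v) ⊓ u')

  cond-least : ∀ {v u u' z} → u ⊑ z → u' ⊑ z → cond v u u' ⊑ z
  cond-least {v} {u} {u'} u⊑z u'⊑z =
    ⊔-least (⊑-trans (x⊓y⊑y v u) u⊑z) (⊑-trans (x⊓y⊑y (- v) u') u'⊑z)

  univalent-cond : ∀ {v u u'} → vector v → univalent u → univalent u' →
                   univalent (cond v u u')
  univalent-cond {v} {u} {u'} v-vec u-univalent u'-univalent = begin
    cond v u u' ᵀ · cond v u u'                  ≡⟨ cong (_· cond v u u') (ᵀ-⊔ (v ⊓ u) (- v ⊓ u')) ⟩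
    ((v ⊓ u) ᵀ ⊔ (- v ⊓ u') ᵀ) · cond v u u'     ≤⟨ ⊔·⊔-least on-v across across' on-compl-v ⟩
    𝟏                                            ∎
    where
    on-v : ((v ⊓ u) ᵀ · (v ⊓ u)) ⊑ 𝟏
    on-v = univalent-antimono (x⊓y⊑y v u) u-univalent
    on-compl-v : ((- v ⊓ u') ᵀ · (- v ⊓ u')) ⊑ 𝟏
    on-compl-v = univalent-antimono (x⊓y⊑y (- v) u') u'-univalent
    across : ((v ⊓ u) ᵀ · (- v ⊓ u')) ⊑ 𝟏
    across = ⊑-trans
      (vector-restriction-ᵀ·-disjoint u u' v-vec (⊑-reflexive (compl-⊓ˡ v))) (⊥⊑x 𝟏)
    across' : ((- v ⊓ u') ᵀ · (v ⊓ u)) ⊑ 𝟏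
    across' = ⊑-trans
      (vector-restriction-ᵀ·-disjoint u' u (vector-compl v-vec) (⊑-reflexive (compl-⊓ v))) (⊥⊑x 𝟏)

  total-cond : ∀ {v u u'} → vector v → total u → total u' → total (cond v u u')
  total-cond {v} {u} {u'} v-vec u-total u'-total = begin
    𝟏                                    ≡⟨ ⊓-compl-split 𝟏 v ⟩
    𝟏 ⊓ v ⊔ 𝟏 ⊓ (- v)                    ≤⟨ ⊔-least on-v on-compl-v ⟩
    cond v u u' · cond v u u' ᵀ          ∎
    where
    on-v : (𝟏 ⊓ v) ⊑ (cond v u u' · cond v u u' ᵀ)
    on-v = ⊑-trans (vector-total-restriction v-vec u-total) (·ᵀ-mono (x⊑x⊔y _ _))
    on-compl-v : (𝟏 ⊓ (- v)) ⊑ (cond v u u' · cond v u u' ᵀ)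
    on-compl-v = ⊑-trans (vector-total-restriction (vector-compl v-vec) u'-total) (·ᵀ-mono (y⊑x⊔y _ _))

  mapping-cond : ∀ {v u u'} → vector v → mapping u → mapping u' → mapping (cond v u u')
  mapping-cond v-vec (u-univalent , u-total) (u'-univalent , u'-total) =
    univalent-cond v-vec u-univalent u'-univalent , total-cond v-vec u-total u'-total

  𝟏⊑star : ∀ q → 𝟏 ⊑ (q *)
  𝟏⊑star q = ⊑-trans (x⊑x⊔y 𝟏 (q ⁺)) (⊑-reflexive (star-unfoldˡ q))

  ⁺⊑star : ∀ q → (q ⁺) ⊑ (q *)
  ⁺⊑star q = ⊑-trans (y⊑x⊔y 𝟏 (q ⁺)) (⊑-reflexive (star-unfoldˡ q))

  star·x⊑star : ∀ q → (q * · q) ⊑ (q *)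
  star·x⊑star q = ⊑-trans (y⊑x⊔y 𝟏 (q * · q)) (⊑-reflexive (star-unfoldʳ q))

  star-trans : ∀ q → (q * · q *) ⊑ (q *)
  star-trans q = star-inductˡ (q *) q (q *) (⊔-least ⊑-refl (⁺⊑star q))

  x⊑⁺ : ∀ q → q ⊑ (q ⁺)
  x⊑⁺ q = begin
    q            ≡⟨ ·-identityʳ q ⟨
    q · 𝟏        ≤⟨ ·-monoʳ q (𝟏⊑star q) ⟩
    q ⁺          ∎

  x⊑star : ∀ q → q ⊑ (q *)
  x⊑star q = ⊑-trans (x⊑⁺ q) (⁺⊑star q)

  ⁺-trans : ∀ q → (q ⁺ · q ⁺) ⊑ (q ⁺)
  ⁺-trans q = begin
    (q · q *) · (q · q *)        ≡⟨ ·-assoc q (q *) (q · q *) ⟩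
    q · (q * · (q · q *))        ≡⟨ cong (q ·_) (·-assoc (q *) q (q *)) ⟨
    q · ((q * · q) · q *)        ≤⟨ ·-monoʳ q (·-monoˡ (q *) (star·x⊑star q)) ⟩
    q · (q * · q *)              ≤⟨ ·-monoʳ q (star-trans q) ⟩
    q · q *                      ∎

  ⁺-least : ∀ {a q} → a ⊑ (q ⁺) → (a ⁺) ⊑ (q ⁺)
  ⁺-least {a} {q} a⊑q⁺ = star-inductʳ (q ⁺) a a
    (⊔-least a⊑q⁺ (⊑-trans (·-monoʳ (q ⁺) a⊑q⁺) (⁺-trans q)))

  star⊓compl𝟏⊑⁺ : ∀ q → (q * ⊓ (- 𝟏)) ⊑ (q ⁺)
  star⊓compl𝟏⊑⁺ q = begin
    q * ⊓ (- 𝟏)                  ≡⟨ cong (_⊓ (- 𝟏)) (star-unfoldˡ q) ⟨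
    (𝟏 ⊔ q ⁺) ⊓ (- 𝟏)            ≡⟨ ⊓-comm (𝟏 ⊔ q ⁺) (- 𝟏) ⟩
    (- 𝟏) ⊓ (𝟏 ⊔ q ⁺)            ≡⟨ ⊓-distrib (- 𝟏) 𝟏 (q ⁺) ⟩
    (- 𝟏) ⊓ 𝟏 ⊔ (- 𝟏) ⊓ q ⁺      ≤⟨ ⊔-least (⊑-trans (⊑-reflexive (compl-⊓ˡ 𝟏)) (⊥⊑x _)) (x⊓y⊑y _ _) ⟩
    q ⁺                          ∎

  x⊑star-⊓compl𝟏 : ∀ x → x ⊑ ((x ⊓ (- 𝟏)) *)
  x⊑star-⊓compl𝟏 x = begin
    x                            ≡⟨ ⊓-compl-split x 𝟏 ⟩
    x ⊓ 𝟏 ⊔ x ⊓ (- 𝟏)            ≤⟨ ⊔-least (⊑-trans (x⊓y⊑y x 𝟏) (𝟏⊑star _)) (x⊑star _) ⟩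
    (x ⊓ (- 𝟏)) *                ∎

  acyclic-⊓compl𝟏-of-⊑star : ∀ {a q} → acyclic q → a ⊑ (q *) → acyclic (a ⊓ (- 𝟏))
  acyclic-⊓compl𝟏-of-⊑star {a} {q} q-acyclic a⊑q* = begin
    (a ⊓ (- 𝟏)) ⁺                ≤⟨ ⁺-least (⊑-trans (⊓-mono a⊑q* ⊑-refl) (star⊓compl𝟏⊑⁺ q)) ⟩
    q ⁺                          ≤⟨ q-acyclic ⟩
    - 𝟏                          ∎

theorem11p9 : ∀ {ℓ} (K : KleeneRelationAlgebra ℓ) → let open KleeneRelationAlgebra K in
    TarskiRule → ∀ x y → forest x → vector y →
    forest ((y ⊓ (x · x)) ⊔ ((- y) ⊓ x))
theorem11p9 K _ x y (x-mapping , x-acyclic) y-vec =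
  mapping-cond y-vec (mapping-· x-mapping x-mapping) x-mapping ,
  acyclic-⊓compl𝟏-of-⊑star x-acyclic (cond-least x·x⊑q* x⊑q*)
  where
  open KleeneRelationAlgebra K
  open KleeneRelationAlgebraProperties K
  x⊑q* : x ⊑ ((x ⊓ (- 𝟏)) *)
  x⊑q* = x⊑star-⊓compl𝟏 x
  x·x⊑q* : (x · x) ⊑ ((x ⊓ (- 𝟏)) *)
  x·x⊑q* = ⊑-trans (·-mono x⊑q* x⊑q*) (star-trans _)
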